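{- Let $k\ge2$ be an integer and $n_0(k):=k^3-k^2+2k-2$. Then for every integer $n\ge n_0(k)+1$, $$\frac{\binom{n-1}{k-1}-\binom{n-k-1}{k-1}+1}{\binom{n-1}{k-1}}<\frac{n}{k(n-2k+2)}.$$
   Context: In the paper the numerator is denoted $\alpha^*(K(n,k))$ (the Hilton–Milner bound) and the denominator $\alpha(K(n,k))$ (the independence number of the Kneser graph $K(n,k)$, equal to $\binom{n-1}{k-1}$ for $n\ge 2k$). -}

module Defs where

open import Data.Nat using (ℕ; zero; suc; _+_; _*_; _∸_; _^_)
open import Data.Nat.Combinatorics using (_C_)
open import Data.Integer using (ℤ; +_) renaming (_+_ to _+ℤ_; _-_ to _-ℤ_)
open import Data.Rational using (ℚ; _/_; 0ℚ)

-- The fraction a / d in ℚ, for an integer a and natural d.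
-- Convention: the value at d = 0 is 0 (never used below, since all
-- denominators in the statement are positive under its hypotheses).
frac : ℤ → ℕ → ℚ
frac a zero    = 0ℚ
frac a (suc d) = a / suc d

n₀ : ℕ → ℕ
n₀ k = k ^ 3 ∸ k ^ 2 + 2 * k ∸ 2

α : ℕ → ℕ → ℕ
α n k = (n ∸ 1) C (k ∸ 1)

-- α*(K(n,k)) = C(n-1,k-1) − C(n-k-1,k-1) + 1  (Hilton–Milner bound), as an integer
α* : ℕ → ℕ → ℤ
α* n k = (+ ((n ∸ 1) C (k ∸ 1)) -ℤ + ((n ∸ k ∸ 1) C (k ∸ 1))) +ℤ + 1

{-# OPTIONS --safe #-}
-- Write A = C(n−1,k−1), B = C(n−k−1,k−1) and D = C(n−2,k−2). Telescoping Pascal's rule,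
-- A − B is a sum of k binomials C(n−2−i,k−2), each at most D, so A − B ≤ k·D; absorption
-- gives (n−1)·D = (k−1)·A. After cross-multiplying, bounding n+2−2k by n−1 and multiplying
-- by k−1, the claim reduces to (k−1)·k·(kD+1) < n·D, which holds once n > (k−1)k² + k since
-- D ≥ k−1. The threshold n₀(k)+1 = (k−1)k² + 2k − 1 is at least that.
module Submission where

open import Defs
open import Data.Nat using (ℕ; _+_; _*_; _∸_; _≤_)
open import Data.Integer using (+_)
open import Data.Rational using (_<_)

open import Data.Nat as ℕ
  using (zero; suc; _^_; s≤s; s≤s⁻¹; z≤n; z<s; _≤′_; ≤′-refl; ≤′-step; NonZero; >-nonZero; >-nonZero⁻¹)
open import Data.Nat.Properties
open import Data.Nat.Combinatorics using (_C_; nCk+nC[k+1]≡[n+1]C[k+1]; nCn≡1; nC1≡n)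
open import Data.Nat.Tactic.RingSolver using (solve-∀)
open import Algebra.Properties.CommutativeSemigroup *-commutativeSemigroup using (x∙yz≈y∙xz)
open import Data.Integer as ℤ using (+<+)
open import Data.Integer.Properties using (m-n≡m⊖n; ⊖-≥; pos-*)
open import Data.Rational.Properties using (toℚᵘ-cancel-<; toℚᵘ-fromℚᵘ)
open import Data.Rational.Unnormalised using (mkℚᵘ; *<*)
open import Data.Rational.Unnormalised.Properties using (<-respˡ-≃; <-respʳ-≃; ≃-sym)
open import Data.Product using (_,_)
open import Relation.Binary.PropositionalEquality

nCk≤[1+n]Ck : ∀ n k → n C k ≤ suc n C k
nCk≤[1+n]Ck n zero    = ≤-refl
nCk≤[1+n]Ck n (suc k) = ≤-trans (m≤n+m (n C suc k) (n C k)) (≤-reflexive (nCk+nC[k+1]≡[n+1]C[k+1] n k))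

C-monoˡ-≤ : ∀ k {m n} → m ≤ n → m C k ≤ n C k
C-monoˡ-≤ k m≤n = go (≤⇒≤′ m≤n)
  where
  go : ∀ {n} → _ ≤′ n → _ C k ≤ n C k
  go ≤′-refl     = ≤-refl
  go (≤′-step p) = ≤-trans (go p) (nCk≤[1+n]Ck _ k)

[1+n]Cn≡1+n : ∀ n → suc n C n ≡ suc n
[1+n]Cn≡1+n zero    = refl
[1+n]Cn≡1+n (suc n) = begin
  suc (suc n) C suc n       ≡⟨ nCk+nC[k+1]≡[n+1]C[k+1] (suc n) n ⟨
  suc n C n + suc n C suc n ≡⟨ cong₂ _+_ ([1+n]Cn≡1+n n) (nCn≡1 (suc n)) ⟩
  suc n + 1                 ≡⟨ +-comm (suc n) 1 ⟩
  suc (suc n)               ∎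
  where open ≡-Reasoning

k<n⇒k<nCk : ∀ {k n} → k ℕ.< n → k ℕ.< n C k
k<n⇒k<nCk {k} {n} k<n = begin-strict
  k         <⟨ n<1+n k ⟩
  suc k     ≡⟨ [1+n]Cn≡1+n k ⟨
  suc k C k ≤⟨ C-monoˡ-≤ k k<n ⟩
  n C k     ∎
  where open ≤-Reasoning

[1+n]*nCk≡[1+k]*[1+n]C[1+k] : ∀ n k → suc n * (n C k) ≡ suc k * (suc n C suc k)
[1+n]*nCk≡[1+k]*[1+n]C[1+k] zero    zero    = refl
[1+n]*nCk≡[1+k]*[1+n]C[1+k] zero    (suc k) = sym (*-zeroʳ (2 + k))
[1+n]*nCk≡[1+k]*[1+n]C[1+k] (suc n) zero    =
  trans (*-identityʳ (2 + n)) (sym (trans (+-identityʳ _) (nC1≡n (2 + n))))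
[1+n]*nCk≡[1+k]*[1+n]C[1+k] (suc n) (suc k) = begin
  (2 + n) * (suc n C suc k)
    ≡⟨ cong ((2 + n) *_) (nCk+nC[k+1]≡[n+1]C[k+1] n k) ⟨
  (2 + n) * (n C k + n C suc k)
    ≡⟨ distrib n (n C k) (n C suc k) ⟩
  ((1 + n) * (n C k) + (1 + n) * (n C suc k)) + (n C k + n C suc k)
    ≡⟨ cong₂ _+_ (cong₂ _+_ ([1+n]*nCk≡[1+k]*[1+n]C[1+k] n k) ([1+n]*nCk≡[1+k]*[1+n]C[1+k] n (suc k)))
                 (nCk+nC[k+1]≡[n+1]C[k+1] n k) ⟩
  ((1 + k) * (suc n C suc k) + (2 + k) * (suc n C (2 + k))) + (suc n C suc k)
    ≡⟨ collect k (suc n C suc k) (suc n C (2 + k)) ⟩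
  (2 + k) * (suc n C suc k + suc n C (2 + k))
    ≡⟨ cong ((2 + k) *_) (nCk+nC[k+1]≡[n+1]C[k+1] (suc n) (suc k)) ⟩
  (2 + k) * ((2 + n) C (2 + k)) ∎
  where
  open ≡-Reasoning
  distrib : ∀ n x y → (2 + n) * (x + y) ≡ ((1 + n) * x + (1 + n) * y) + (x + y)
  distrib = solve-∀
  collect : ∀ k x y → ((1 + k) * x + (2 + k) * y) + x ≡ (2 + k) * (x + y)
  collect = solve-∀

[1+s+a]C[1+k]≤aC[1+k]+[1+s]*[s+a]Ck : ∀ a s k → (suc s + a) C suc k ≤ a C suc k + suc s * ((s + a) C k)
[1+s+a]C[1+k]≤aC[1+k]+[1+s]*[s+a]Ck a zero k = begin
  suc a C suc k         ≡⟨ nCk+nC[k+1]≡[n+1]C[k+1] a k ⟨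
  a C k + a C suc k     ≡⟨ +-comm (a C k) (a C suc k) ⟩
  a C suc k + a C k     ≡⟨ cong (_+_ (a C suc k)) (*-identityˡ (a C k)) ⟨
  a C suc k + 1 * (a C k) ∎
  where open ≤-Reasoning
[1+s+a]C[1+k]≤aC[1+k]+[1+s]*[s+a]Ck a (suc s) k = begin
  (2 + s + a) C suc k
    ≡⟨ nCk+nC[k+1]≡[n+1]C[k+1] (suc s + a) k ⟨
  c + (suc s + a) C suc k
    ≤⟨ +-monoʳ-≤ c ([1+s+a]C[1+k]≤aC[1+k]+[1+s]*[s+a]Ck a s k) ⟩
  c + (a C suc k + suc s * ((s + a) C k))
    ≤⟨ +-monoʳ-≤ c (+-monoʳ-≤ (a C suc k) (*-monoʳ-≤ (suc s) (nCk≤[1+n]Ck (s + a) k))) ⟩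
  c + (a C suc k + suc s * c)
    ≡⟨ collect s c (a C suc k) ⟩
  a C suc k + (2 + s) * c ∎
  where
  open ≤-Reasoning
  c = (suc s + a) C k
  collect : ∀ s c b → c + (b + suc s * c) ≡ b + (2 + s) * c
  collect = solve-∀

-- A, B, D as above, with m = n − 1 and N = n + 2 − 2k.
cross-multiplied-bound : ∀ r {A B D m n N} .{{_ : NonZero r}} .{{_ : NonZero m}} → let k = suc r in
  A ≤ B + k * D → m * D ≡ r * A → r ≤ D → N ≤ m → r * (k * k) + k ℕ.< n →
  (A ∸ B + 1) * (k * N) ℕ.< n * A
cross-multiplied-bound r {A} {B} {D} {m} {n} {N} A≤B+kD mD≡rA r≤D N≤m threshold =
  *-cancelˡ-< r _ _ (begin-strict
    r * ((A ∸ B + 1) * (k * N)) ≤⟨ *-monoʳ-≤ r (*-mono-≤ A∸B+1≤kD+1 (*-monoʳ-≤ k N≤m)) ⟩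
    r * ((k * D + 1) * (k * m)) ≡⟨ regroup r D m ⟩
    m * (r * k * (k * D + 1))   <⟨ *-monoʳ-< m per-unit ⟩
    m * (n * D)                 ≡⟨ x∙yz≈y∙xz m n D ⟩
    n * (m * D)                 ≡⟨ cong (n *_) mD≡rA ⟩
    n * (r * A)                 ≡⟨ x∙yz≈y∙xz n r A ⟩
    r * (n * A)                 ∎)
  where
  open ≤-Reasoning
  k = suc r
  instance
    _ : NonZero D
    _ = >-nonZero (<-≤-trans (>-nonZero⁻¹ r) r≤D)
  A∸B+1≤kD+1 : A ∸ B + 1 ≤ k * D + 1
  A∸B+1≤kD+1 = +-monoˡ-≤ 1 (m≤n+o⇒m∸n≤o A B A≤B+kD)
  regroup : ∀ r D m → r * ((suc r * D + 1) * (suc r * m)) ≡ m * (r * suc r * (suc r * D + 1))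
  regroup = solve-∀
  expand : ∀ r D → r * suc r * (suc r * D + 1) ≡ r * (suc r * suc r) * D + suc r * r
  expand = solve-∀
  per-unit : r * k * (k * D + 1) ℕ.< n * D
  per-unit = begin-strict
    r * k * (k * D + 1)       ≡⟨ expand r D ⟩
    r * (k * k) * D + k * r   ≤⟨ +-monoʳ-≤ (r * (k * k) * D) (*-monoʳ-≤ k r≤D) ⟩
    r * (k * k) * D + k * D   ≡⟨ *-distribʳ-+ D (r * (k * k)) k ⟨
    (r * (k * k) + k) * D     <⟨ *-monoˡ-< D threshold ⟩
    n * D                     ∎

frac-< : ∀ {x y d e} → 0 ℕ.< d → 0 ℕ.< e → x ℤ.* + e ℤ.< y ℤ.* + d → frac x d < frac y e
frac-< {x} {y} {suc d} {suc e} _ _ xe<yd = toℚᵘ-cancel-<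
  (<-respˡ-≃ (≃-sym (toℚᵘ-fromℚᵘ (mkℚᵘ x d)))
    (<-respʳ-≃ (≃-sym (toℚᵘ-fromℚᵘ (mkℚᵘ y e))) (*<* xe<yd)))

+m-+n+1≡+[m∸n+1] : ∀ {m n} → n ≤ m → (+ m ℤ.- + n) ℤ.+ + 1 ≡ + (m ∸ n + 1)
+m-+n+1≡+[m∸n+1] {m} {n} n≤m = cong (ℤ._+ + 1) (trans (m-n≡m⊖n m n) (⊖-≥ n≤m))

n₀[1+r]+1≡1+r+[r*[1+r]²+r] : ∀ r → n₀ (suc r) + 1 ≡ suc r + (r * (suc r * suc r) + r)
n₀[1+r]+1≡1+r+[r*[1+r]²+r] r = begin
  k ^ 3 ∸ k ^ 2 + 2 * k ∸ 2 + 1     ≡⟨ cong (λ x → x ∸ k ^ 2 + 2 * k ∸ 2 + 1) (cube r) ⟩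
  P + k ^ 2 ∸ k ^ 2 + 2 * k ∸ 2 + 1 ≡⟨ cong (λ x → x + 2 * k ∸ 2 + 1) (m+n∸n≡m P (k ^ 2)) ⟩
  P + 2 * k ∸ 2 + 1                 ≡⟨ cong (λ x → x ∸ 2 + 1) (double r P) ⟩
  P + 2 * r + 2 ∸ 2 + 1             ≡⟨ cong (_+ 1) (m+n∸n≡m (P + 2 * r) 2) ⟩
  P + 2 * r + 1                     ≡⟨ regroup r P ⟩
  k + (P + r)                       ∎
  where
  open ≡-Reasoning
  k = suc r
  P = r * (k * k)
  cube : ∀ r → suc r * (suc r * (suc r * 1)) ≡ r * (suc r * suc r) + suc r * (suc r * 1)
  cube = solve-∀
  double : ∀ r P → P + 2 * suc r ≡ P + 2 * r + 2
  double = solve-∀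
  regroup : ∀ r P → P + 2 * r + 1 ≡ suc r + (P + r)
  regroup = solve-∀

k<n₀[k]+1 : ∀ j → 2 + j ℕ.< n₀ (2 + j) + 1
k<n₀[k]+1 j = subst (2 + j ℕ.<_) (sym (n₀[1+r]+1≡1+r+[r*[1+r]²+r] (suc j)))
  (m<m+n (2 + j) (<-≤-trans z<s (m≤n+m (suc j) (suc j * ((2 + j) * (2 + j))))))

n₀[k]<1+k+a⇒r*k²≤a : ∀ j a → let r = suc j ; k = suc r in
  n₀ k + 1 ≤ suc (k + a) → r * (k * k) ≤ a
n₀[k]<1+k+a⇒r*k²≤a j a n₀<n = ≤-trans (m≤m+n P j) (s≤s⁻¹ (subst (_≤ suc a) (+-suc P j) P+r≤1+a))
  where
  r = suc j
  k = suc r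
  P = r * (k * k)
  P+r≤1+a : P + r ≤ suc a
  P+r≤1+a = +-cancelˡ-≤ k _ _
    (subst₂ _≤_ (n₀[1+r]+1≡1+r+[r*[1+r]²+r] r) (sym (+-suc k a)) n₀<n)

hilton-milner-ratio-bound : ∀ j a → let r = suc j ; k = suc r ; n = suc (k + a) in
  r * (k * k) ≤ a → frac (α* n k) (α n k) < frac (+ n) (k * (n + 2 ∸ 2 * k))
hilton-milner-ratio-bound j a P≤a = subst (λ x → frac x A < frac (+ n) K) (sym numerator)
  (frac-< 0<A 0<K (subst₂ ℤ._<_ (pos-* (A ∸ B + 1) K) (pos-* n A)
    (+<+ (cross-multiplied-bound r {B = B}
      ([1+s+a]C[1+k]≤aC[1+k]+[1+s]*[s+a]Ck a r j)
      ([1+n]*nCk≡[1+k]*[1+n]C[1+k] (r + a) j)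
      (k<n⇒k<nCk (s≤s (m≤m+n j a)))
      N≤m
      (s≤s (≤-trans (+-monoˡ-≤ k P≤a) (≤-reflexive (+-comm a k))))))))
  where
  r = suc j
  k = suc r
  m = k + a
  n = suc m
  A = m C r
  B = a C r
  N = n + 2 ∸ 2 * k
  K = k * N
  numerator : α* n k ≡ + (A ∸ B + 1)
  numerator = trans (cong (λ b → (+ A ℤ.- + (b C r)) ℤ.+ + 1) n∸k∸1≡a)
    (+m-+n+1≡+[m∸n+1] (C-monoˡ-≤ r (m≤n+m a k)))
    where
    n∸k∸1≡a : n ∸ k ∸ 1 ≡ a
    n∸k∸1≡a = trans (∸-+-assoc n k 1) (trans (cong (n ∸_) (+-comm k 1)) (m+n∸m≡n k a))
  0<A : 0 ℕ.< A
  0<A = <-trans z<s (k<n⇒k<nCk (s≤s (m≤m+n r a)))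
  k≤a : k ≤ a
  k≤a = ≤-trans (≤-trans (m≤m*n k k) (m≤n*m (k * k) r)) P≤a
  2k<n+2 : 2 * k ℕ.< n + 2
  2k<n+2 = ≤-trans (s≤s (+-monoʳ-≤ k (subst (_≤ a) (sym (+-identityʳ k)) k≤a))) (m≤m+n n 2)
  0<K : 0 ℕ.< K
  0<K = *-mono-≤ {1} {k} (s≤s z≤n) (m<n⇒0<n∸m 2k<n+2)
  N≤m : N ≤ m
  N≤m = ≤-trans (∸-monoʳ-≤ (n + 2) (≤-trans (n≤1+n 3) (*-monoʳ-≤ 2 {2} {k} (s≤s (s≤s z≤n)))))
    (≤-reflexive (cong (_∸ 3) (+-comm n 2)))

lemma3p5 : (k : ℕ) → 2 ≤ k → (n : ℕ) → n₀ k + 1 ≤ n →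
    frac (α* n k) (α n k) < frac (+ n) (k * (n + 2 ∸ 2 * k))
lemma3p5 (suc (suc j)) (s≤s (s≤s z≤n)) n n₀<n with m≤n⇒∃[o]m+o≡n (≤-trans (k<n₀[k]+1 j) n₀<n)
... | a , refl = hilton-milner-ratio-bound j a (n₀[k]<1+k+a⇒r*k²≤a j a n₀<n)
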